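{- Let $\mathcal{M}_d$ denote the set of $0/1$-matrices of rank $d$ with no repeated row and no repeated column. A matrix in $\mathcal{M}_d$ is \emph{maximal} if it is not a submatrix of another matrix in $\mathcal{M}_d$. Then the number of maximal elements of $\mathcal{M}_d$, counted up to permutation of rows and columns, is $2^{O(d^3)}$.
   Context: Rank is over the reals. A submatrix of a matrix is obtained by deleting some of its rows and some of its columns. -}

module Defs where

open import Data.Nat using (ℕ; zero; suc)
open import Data.Bool using (Bool; true; false)
open import Data.Fin using (Fin; zero; suc; _<_)
open import Data.Rational using (ℚ; 0ℚ; 1ℚ; _+_; _*_)
open import Data.Product using (Σ; _×_; ∃; ∃-syntax; _,_)
open import Relation.Binary.PropositionalEquality using (_≡_)
open import Relation.Nullary using (¬_)
open import Function.Definitions using (Injective)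
open import Function.Bundles using (_↔_; Inverse)

Mat01 : ℕ → ℕ → Set
Mat01 m n = Fin m → Fin n → Bool

-- entries viewed as rationals (rank of a 0/1 matrix over ℝ equals its rank over ℚ)
toℚ : Bool → ℚ
toℚ true  = 1ℚ
toℚ false = 0ℚ

sumFin : (k : ℕ) → (Fin k → ℚ) → ℚ
sumFin zero    f = 0ℚ
sumFin (suc k) f = f zero + sumFin k (λ i → f (suc i))

LinIndep : {k n : ℕ} → (Fin k → Fin n → ℚ) → Set
LinIndep {k} {n} v =
  (c : Fin k → ℚ) → ((j : Fin n) → sumFin k (λ i → c i * v i j) ≡ 0ℚ) →
  (i : Fin k) → c i ≡ 0ℚ

IndepRows : {m n k : ℕ} → Mat01 m n → (Fin k → Fin m) → Set
IndepRows A σ = LinIndep (λ i j → toℚ (A (σ i) j))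

HasRank : {m n : ℕ} → Mat01 m n → ℕ → Set
HasRank {m} A r =
  (Σ (Fin r → Fin m) λ σ → Injective _≡_ _≡_ σ × IndepRows A σ) ×
  ((σ : Fin (suc r) → Fin m) → Injective _≡_ _≡_ σ → ¬ IndepRows A σ)

NoRepeatedRow : {m n : ℕ} → Mat01 m n → Set
NoRepeatedRow {m} {n} A = (i i' : Fin m) → ((j : Fin n) → A i j ≡ A i' j) → i ≡ i'

NoRepeatedCol : {m n : ℕ} → Mat01 m n → Set
NoRepeatedCol {m} {n} A = (j j' : Fin n) → ((i : Fin m) → A i j ≡ A i j') → j ≡ j'

InM : ℕ → {m n : ℕ} → Mat01 m n → Set
InM d A = HasRank A d × NoRepeatedRow A × NoRepeatedCol A

StrictlyIncreasing : {a b : ℕ} → (Fin a → Fin b) → Set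
StrictlyIncreasing {a} f = (i j : Fin a) → i < j → f i < f j

SubmatrixOf : {p q m n : ℕ} → Mat01 p q → Mat01 m n → Set
SubmatrixOf {p} {q} {m} {n} A B =
  Σ (Fin p → Fin m) λ f → Σ (Fin q → Fin n) λ g →
    StrictlyIncreasing f × StrictlyIncreasing g ×
    ((i : Fin p) (j : Fin q) → A i j ≡ B (f i) (g j))

-- A ∈ 𝓜_d is maximal: every B ∈ 𝓜_d having A as a submatrix has the same
-- dimensions as A (hence, being a submatrix with equal dimensions, B = A)
Maximal : ℕ → {p q : ℕ} → Mat01 p q → Set
Maximal d {p} {q} A =
  InM d A ×
  ((m n : ℕ) (B : Mat01 m n) → InM d B → SubmatrixOf A B → (p ≡ m) × (q ≡ n))

AnyMat : Set
AnyMat = Σ ℕ λ m → Σ ℕ λ n → Mat01 m n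

PermEquiv : {m n m' n' : ℕ} → Mat01 m n → Mat01 m' n' → Set
PermEquiv {m} {n} {m'} {n'} A B =
  Σ (Fin m ↔ Fin m') λ e → Σ (Fin n ↔ Fin n') λ f →
    ((i : Fin m) (j : Fin n) → A i j ≡ B (Inverse.to e i) (Inverse.to f j))

PermEquivAny : {m n : ℕ} → Mat01 m n → AnyMat → Set
PermEquivAny A (_ , _ , B) = PermEquiv A B

-- Let A be maximal of rank d. Choose d rows σ spanning the row space and d columns τ on which they form a
-- nonsingular d × d core N. Every row is a combination λᵢ of the rows σ, so Aᵢⱼ = λᵢ · wⱼ with wⱼ = A[σ, j],
-- and λᵢ is determined by the pattern uᵢ = A[i, τ] through λᵢ N = uᵢ. By maximality the columns of A are
-- exactly the 0/1 vectors y with λᵢ · y ∈ {0, 1} for all i, and the rows are exactly the 0/1 vectors x with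
-- (x N⁻¹) · wⱼ ∈ {0, 1} for all j: a missing one could be appended without changing the rank. Since
-- t ∈ {0, 1} iff t (t - 1) = 0, the condition on y is linear in the monomials of (1, y), so it suffices to
-- test it on (d + 1)² rows whose quadrics span those of all rows. Hence A is determined up to permutations by
-- N and the patterns of these rows, which leaves at most 2 ^ (d (d + (d + 1)²)) ≤ 2 ^ (5 d³) possibilities.

module Submission where

open import Defs
open import Algebra.Bundles using (CommutativeRing)
open import Data.Bool as Bool using (Bool; true; false)
open import Data.Empty using (⊥-elim)
open import Data.Fin as Fin
  using (Fin; zero; suc; punchIn; _↑ˡ_; _↑ʳ_; combine; remQuot; inject≤; funToFin; finToFun)
open import Data.Fin.Properties
  using (punchIn-punchOut; all?; any?; ¬∀⟶∃¬; remQuot-combine; 2↔Bool; funToFin-finToFin; finToFun-funToFin;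
         splitAt-↑ˡ; splitAt-↑ʳ; suc-injective)
open import Data.List as List using (List)
import Data.List.Properties as List
open import Data.List.Membership.Propositional using (_∈_; lose)
open import Data.List.Membership.Propositional.Properties using (∈-lookup; ∈-filter⁺; ∈-filter⁻; ∈-allFin; ∈-map⁺)
open import Data.List.Relation.Unary.All as All using (All)
import Data.List.Relation.Unary.AllPairs as AllPairs
open import Data.List.Relation.Unary.Any as Any using (Any)
open import Data.List.Relation.Unary.Any.Properties using (lookup-index)
open import Data.List.Relation.Unary.Unique.Propositional using (Unique)
open import Data.List.Relation.Unary.Unique.Propositional.Properties using (filter⁺; allFin⁺)
open import Data.Nat as ℕ using (ℕ; zero; suc; _≤_; z≤n; s≤s; _^_)
import Data.Nat.Properties as ℕ
open import Data.Nat.Tactic.RingSolver using (solve-∀)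
open import Data.Product using (Σ; ∃; ∃-syntax; _×_; _,_; proj₁; proj₂; uncurry; map₂)
open import Data.Rational using (ℚ; 0ℚ; 1ℚ; _+_; _*_; -_; 1/_; ≢-nonZero)
open import Data.Rational.Properties
  using (+-*-commutativeRing; +-0-group; _≟_; 1≢0; +-identityˡ; +-identityʳ; +-assoc;
         *-identityˡ; *-identityʳ; *-zeroˡ; *-zeroʳ; *-assoc; *-comm; *-inverseˡ; *-inverseʳ)
open import Data.Rational.Solver using (module +-*-Solver)
open import Data.Sum using (_⊎_; inj₁; inj₂; [_,_]′)
import Data.Sum as Sum
open import Data.Vec.Functional using (Vector; _∷_; tail; insertAt; removeAt)
open import Data.Vec.Functional.Properties using (insertAt-lookup; insertAt-punchIn)
open import Function using (_∘_)
open import Function.Bundles using (_↔_; Inverse; mk↔ₛ′; _⇔_; mk⇔; Equivalence)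
open import Function.Definitions using (Injective)
open import Relation.Binary.PropositionalEquality
open import Relation.Nullary using (¬_; Dec; yes; no; does; _⊎-dec_)

open import Algebra.Properties.Group +-0-group using (inverseˡ-unique; inverseʳ-unique)
open import Algebra.Properties.Semiring.Sum (CommutativeRing.semiring +-*-commutativeRing)
  using (sum; sum-cong-≗; sum-replicate-zero; sum-remove; ∑-comm; ∑-distrib-+; *-distribˡ-sum; *-distribʳ-sum)
open +-*-Solver

private variable
  k k′ n r : ℕ

sumFin≡sum : ∀ k (f : Vector ℚ k) → sumFin k f ≡ sum f
sumFin≡sum zero    f = refl
sumFin≡sum (suc k) f = cong (f zero +_) (sumFin≡sum k (f ∘ suc))

∑-zero : {f : Vector ℚ n} → (∀ i → f i ≡ 0ℚ) → sum f ≡ 0ℚ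
∑-zero {n} h = trans (sum-cong-≗ h) (sum-replicate-zero n)

infixl 7 _·_

_·_ : Vector ℚ n → Vector ℚ n → ℚ
u · v = sum (λ i → u i * v i)

lincomb : Vector ℚ k → (Fin k → Vector ℚ n) → Vector ℚ n
lincomb c v j = c · (λ i → v i j)

·-zeroˡ : {u v : Vector ℚ n} → (∀ i → u i ≡ 0ℚ) → u · v ≡ 0ℚ
·-zeroˡ {v = v} h = ∑-zero (λ i → trans (cong (_* v i) (h i)) (*-zeroˡ (v i)))

·-zeroʳ : {u v : Vector ℚ n} → (∀ i → v i ≡ 0ℚ) → u · v ≡ 0ℚ
·-zeroʳ {u = u} h = ∑-zero (λ i → trans (cong (u i *_) (h i)) (*-zeroʳ (u i)))

·-congˡ : {u u′ : Vector ℚ n} (v : Vector ℚ n) → (∀ i → u i ≡ u′ i) → u · v ≡ u′ · v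
·-congˡ v u≗u′ = sum-cong-≗ (λ i → cong (_* v i) (u≗u′ i))

·-congʳ : (u : Vector ℚ n) {v v′ : Vector ℚ n} → (∀ i → v i ≡ v′ i) → u · v ≡ u · v′
·-congʳ u v≗v′ = sum-cong-≗ (λ i → cong (u i *_) (v≗v′ i))

·-comm : (u v : Vector ℚ n) → u · v ≡ v · u
·-comm u v = sum-cong-≗ (λ i → *-comm (u i) (v i))

·-linearʳ : ∀ (u x y : Vector ℚ n) a b → u · (λ i → a * x i + b * y i) ≡ a * (u · x) + b * (u · y)
·-linearʳ u x y a b = begin
  u · (λ i → a * x i + b * y i)
    ≡⟨ sum-cong-≗ (λ i → solve 5 (λ ui xi yi a b → ui :* (a :* xi :+ b :* yi)
                                                 := a :* (ui :* xi) :+ b :* (ui :* yi))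
                                   refl (u i) (x i) (y i) a b) ⟩
  sum (λ i → a * (u i * x i) + b * (u i * y i))
    ≡⟨ ∑-distrib-+ (λ i → a * (u i * x i)) (λ i → b * (u i * y i)) ⟩
  sum (λ i → a * (u i * x i)) + sum (λ i → b * (u i * y i))
    ≡⟨ sym (cong₂ _+_ (*-distribˡ-sum a (λ i → u i * x i)) (*-distribˡ-sum b (λ i → u i * y i))) ⟩
  a * (u · x) + b * (u · y) ∎
  where open ≡-Reasoning

·-scaleˡ : ∀ (u v : Vector ℚ n) a → (λ i → u i * a) · v ≡ a * (u · v)
·-scaleˡ u v a = begin
  sum (λ i → (u i * a) * v i)
    ≡⟨ sum-cong-≗ (λ i → solve 3 (λ x a y → (x :* a) :* y := a :* (x :* y)) refl (u i) a (v i)) ⟩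
  sum (λ i → a * (u i * v i))
    ≡⟨ sym (*-distribˡ-sum a (λ i → u i * v i)) ⟩
  a * (u · v) ∎
  where open ≡-Reasoning

lincomb-· : ∀ (c : Vector ℚ k) (M : Fin k → Vector ℚ n) b → lincomb c M · b ≡ c · (λ i → M i · b)
lincomb-· c M b = begin
  sum (λ j → sum (λ i → c i * M i j) * b j)
    ≡⟨ sum-cong-≗ (λ j → *-distribʳ-sum (b j) (λ i → c i * M i j)) ⟩
  sum (λ j → sum (λ i → (c i * M i j) * b j))
    ≡⟨ ∑-comm (λ j i → (c i * M i j) * b j) ⟩
  sum (λ i → sum (λ j → (c i * M i j) * b j))
    ≡⟨ sum-cong-≗ (λ i → trans (sum-cong-≗ (λ j → *-assoc (c i) (M i j) (b j)))
                               (sym (*-distribˡ-sum (c i) (λ j → M i j * b j)))) ⟩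
  c · (λ i → M i · b) ∎
  where open ≡-Reasoning

lincomb-assoc : ∀ (c : Vector ℚ k) (α : Fin k → Vector ℚ r) (v : Fin r → Vector ℚ n) j →
  lincomb c (λ i → lincomb (α i) v) j ≡ lincomb (lincomb c α) v j
lincomb-assoc c α v j = sym (lincomb-· c α (λ t → v t j))

lincomb-cong : (c : Vector ℚ k) {v w : Fin k → Vector ℚ n} → (∀ i j → v i j ≡ w i j) →
  ∀ j → lincomb c v j ≡ lincomb c w j
lincomb-cong c v≗w j = ·-congʳ c (λ i → v≗w i j)

lincomb-linear : ∀ (α β : Vector ℚ k) (v : Fin k → Vector ℚ n) a b j →
  lincomb (λ i → a * α i + b * β i) v j ≡ a * lincomb α v j + b * lincomb β v j
lincomb-linear α β v a b j = begin
  lincomb (λ i → a * α i + b * β i) v j              ≡⟨ ·-comm _ (λ i → v i j) ⟩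
  (λ i → v i j) · (λ i → a * α i + b * β i)          ≡⟨ ·-linearʳ (λ i → v i j) α β a b ⟩
  a * ((λ i → v i j) · α) + b * ((λ i → v i j) · β)  ≡⟨ cong₂ (λ x y → a * x + b * y) (·-comm _ α) (·-comm _ β) ⟩
  a * lincomb α v j + b * lincomb β v j              ∎
  where open ≡-Reasoning

unit : Fin k → Vector ℚ k
unit {suc k} t = insertAt (λ _ → 0ℚ) t 1ℚ

unit-· : ∀ t (y : Vector ℚ k) → unit t · y ≡ y t
unit-· {suc k} t y = begin
  unit t · y
    ≡⟨ sum-remove {i = t} (λ i → unit t i * y i) ⟩
  unit t t * y t + sum (λ a → unit t (punchIn t a) * y (punchIn t a))
    ≡⟨ cong₂ _+_ (trans (cong (_* y t) (insertAt-lookup _ t _)) (*-identityˡ (y t)))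
                 (·-zeroˡ (λ a → insertAt-punchIn _ t _ a)) ⟩
  y t + 0ℚ
    ≡⟨ +-identityʳ (y t) ⟩
  y t ∎
  where open ≡-Reasoning

*-cancelʳ-≡0 : ∀ {p q} → p ≢ 0ℚ → q * p ≡ 0ℚ → q ≡ 0ℚ
*-cancelʳ-≡0 {p} {q} p≢0 qp≡0 = begin
  q              ≡⟨ sym (*-identityʳ q) ⟩
  q * 1ℚ         ≡⟨ cong (q *_) (sym (*-inverseʳ p)) ⟩
  q * (p * 1/ p) ≡⟨ sym (*-assoc q p (1/ p)) ⟩
  q * p * 1/ p   ≡⟨ cong (_* 1/ p) qp≡0 ⟩
  0ℚ * 1/ p      ≡⟨ *-zeroˡ (1/ p) ⟩
  0ℚ             ∎
  where open ≡-Reasoning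
        instance _ = ≢-nonZero p≢0

-- Linear independence and Gaussian elimination

-- `LinIndep` of Defs, stated with the library's `sum` instead of `sumFin`.
Independent : (Fin k → Vector ℚ n) → Set
Independent v = ∀ c → (∀ j → lincomb c v j ≡ 0ℚ) → ∀ i → c i ≡ 0ℚ

Dependent : (Fin k → Vector ℚ n) → Set
Dependent v = Σ (Vector ℚ _) λ c → (∀ j → lincomb c v j ≡ 0ℚ) × ∃ λ i → c i ≢ 0ℚ

LinIndep⇒Independent : {v : Fin k → Vector ℚ n} → LinIndep v → Independent v
LinIndep⇒Independent {k} ind c h = ind c (λ j → trans (sumFin≡sum k _) (h j))

Independent⇒LinIndep : {v : Fin k → Vector ℚ n} → Independent v → LinIndep v
Independent⇒LinIndep {k} ind c h = ind c (λ j → trans (sym (sumFin≡sum k _)) (h j))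

Independent-cong : {v w : Fin k → Vector ℚ n} → (∀ i j → v i j ≡ w i j) → Independent v → Independent w
Independent-cong v≗w ind c h = ind c (λ j → trans (lincomb-cong c v≗w j) (h j))

Independent-tail : {v : Fin k → Vector ℚ (suc n)} → Independent (tail ∘ v) → Independent v
Independent-tail ind c h = ind c (h ∘ suc)

module Elimination (v : Fin (suc k) → Vector ℚ (suc n)) (i₀ : Fin (suc k)) (p≢0 : v i₀ zero ≢ 0ℚ) where

  p : ℚ
  p = v i₀ zero

  others : Fin k → Vector ℚ (suc n)
  others = removeAt v i₀

  eliminated : Fin k → Vector ℚ n
  eliminated a j = p * others a (suc j) + (- v i₀ (suc j)) * others a zero

  lincomb-eliminated : ∀ c j →
    lincomb c eliminated j ≡ p * lincomb c others (suc j) + (- v i₀ (suc j)) * lincomb c others zero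
  lincomb-eliminated c j = ·-linearʳ c (λ a → others a (suc j)) (λ a → others a zero) p (- v i₀ (suc j))

  lincomb-removeAt : ∀ c j → lincomb c v j ≡ c i₀ * v i₀ j + lincomb (removeAt c i₀) others j
  lincomb-removeAt c j = sum-remove {i = i₀} (λ i → c i * v i j)

  lift : Vector ℚ k → Vector ℚ (suc k)
  lift c = insertAt (λ a → c a * p) i₀ (- lincomb c others zero)

  lincomb-lift : ∀ c j → lincomb (lift c) v j ≡ - lincomb c others zero * v i₀ j + p * lincomb c others j
  lincomb-lift c j = begin
    lincomb (lift c) v j
      ≡⟨ lincomb-removeAt (lift c) j ⟩
    lift c i₀ * v i₀ j + lincomb (removeAt (lift c) i₀) others j
      ≡⟨ cong₂ (λ x y → x * v i₀ j + y) (insertAt-lookup _ i₀ _)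
               (trans (·-congˡ _ (insertAt-punchIn _ i₀ _)) (·-scaleˡ c (λ a → others a j) p)) ⟩
    - lincomb c others zero * v i₀ j + p * lincomb c others j ∎
    where open ≡-Reasoning

  lift-relation : ∀ c → (∀ j → lincomb c eliminated j ≡ 0ℚ) → ∀ j → lincomb (lift c) v j ≡ 0ℚ
  lift-relation c h zero = trans (lincomb-lift c zero)
    (solve 2 (λ s p → (:- s) :* p :+ p :* s := con 0ℚ) refl (lincomb c others zero) p)
  lift-relation c h (suc j) = begin
    lincomb (lift c) v (suc j)
      ≡⟨ lincomb-lift c (suc j) ⟩
    - lincomb c others zero * v i₀ (suc j) + p * lincomb c others (suc j)
      ≡⟨ solve 4 (λ s q p t → (:- s) :* q :+ p :* t := p :* t :+ (:- q) :* s) refl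
                 (lincomb c others zero) (v i₀ (suc j)) p (lincomb c others (suc j)) ⟩
    p * lincomb c others (suc j) + (- v i₀ (suc j)) * lincomb c others zero
      ≡⟨ sym (lincomb-eliminated c j) ⟩
    lincomb c eliminated j
      ≡⟨ h j ⟩
    0ℚ ∎
    where open ≡-Reasoning

  removeAt-relation : ∀ c → (∀ j → lincomb c v j ≡ 0ℚ) → ∀ j → lincomb (removeAt c i₀) eliminated j ≡ 0ℚ
  removeAt-relation c h j = begin
    lincomb (removeAt c i₀) eliminated j
      ≡⟨ lincomb-eliminated (removeAt c i₀) j ⟩
    p * lincomb (removeAt c i₀) others (suc j) + (- v i₀ (suc j)) * lincomb (removeAt c i₀) others zero
      ≡⟨ cong₂ (λ x y → p * x + (- v i₀ (suc j)) * y) (rest (suc j)) (rest zero) ⟩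
    p * - (c i₀ * v i₀ (suc j)) + (- v i₀ (suc j)) * - (c i₀ * p)
      ≡⟨ solve 3 (λ p c q → p :* (:- (c :* q)) :+ (:- q) :* (:- (c :* p)) := con 0ℚ) refl p (c i₀) (v i₀ (suc j)) ⟩
    0ℚ ∎
    where
    open ≡-Reasoning
    rest : ∀ j → lincomb (removeAt c i₀) others j ≡ - (c i₀ * v i₀ j)
    rest j = inverseʳ-unique (c i₀ * v i₀ j) _ (trans (sym (lincomb-removeAt c j)) (h j))

  independent-eliminated⇒independent : Independent eliminated → Independent v
  independent-eliminated⇒independent ind c h i with i Fin.≟ i₀
  ... | yes refl = *-cancelʳ-≡0 p≢0 (begin
    c i₀ * p                                       ≡⟨ sym (+-identityʳ _) ⟩
    c i₀ * p + 0ℚ                                  ≡⟨ cong (c i₀ * p +_) (sym (·-zeroˡ rest≡0)) ⟩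
    c i₀ * p + lincomb (removeAt c i₀) others zero ≡⟨ sym (lincomb-removeAt c zero) ⟩
    lincomb c v zero                               ≡⟨ h zero ⟩
    0ℚ                                             ∎)
    where
    open ≡-Reasoning
    rest≡0 : ∀ a → c (punchIn i₀ a) ≡ 0ℚ
    rest≡0 = ind (removeAt c i₀) (removeAt-relation c h)
  ... | no i≢i₀ = trans (cong c (sym (punchIn-punchOut (i≢i₀ ∘ sym))))
                        (ind (removeAt c i₀) (removeAt-relation c h) _)

  dependent-eliminated⇒dependent : Dependent eliminated → Dependent v
  dependent-eliminated⇒dependent (c , h , a , cₐ≢0) =
    lift c , lift-relation c h , punchIn i₀ a ,
    λ e → cₐ≢0 (*-cancelʳ-≡0 p≢0 (trans (sym (insertAt-punchIn _ i₀ _ a)) e))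

  independent⇒independent-eliminated : Independent v → Independent eliminated
  independent⇒independent-eliminated ind c h a =
    *-cancelʳ-≡0 p≢0 (trans (sym (insertAt-punchIn _ i₀ _ a)) (ind (lift c) (lift-relation c h) (punchIn i₀ a)))

module DropZeroColumn (v : Fin k → Vector ℚ (suc n)) (zeros : ∀ i → v i zero ≡ 0ℚ) where

  dropped : Fin k → Vector ℚ n
  dropped = tail ∘ v

  extend-relation : ∀ c → (∀ j → lincomb c dropped j ≡ 0ℚ) → ∀ j → lincomb c v j ≡ 0ℚ
  extend-relation c h zero    = ·-zeroʳ {u = c} zeros
  extend-relation c h (suc j) = h j

  dependent-dropped⇒dependent : Dependent dropped → Dependent v
  dependent-dropped⇒dependent (c , h , nonzero) = c , extend-relation c h , nonzero

  independent⇒independent-dropped : Independent v → Independent dropped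
  independent⇒independent-dropped ind c h = ind c (extend-relation c h)

pivot? : (v : Fin k → Vector ℚ (suc n)) → (∃ λ i → v i zero ≢ 0ℚ) ⊎ (∀ i → v i zero ≡ 0ℚ)
pivot? {k} v with all? (λ i → v i zero ≟ 0ℚ)
... | yes zeros  = inj₂ zeros
... | no ¬zeros = inj₁ (¬∀⟶∃¬ k (λ i → v i zero ≡ 0ℚ) (λ i → v i zero ≟ 0ℚ) ¬zeros)

independent⊎dependent : (v : Fin k → Vector ℚ n) → Independent v ⊎ Dependent v
independent⊎dependent {zero}          v = inj₁ (λ c _ ())
independent⊎dependent {suc k} {zero}  v = inj₂ ((λ _ → 1ℚ) , (λ ()) , zero , 1≢0)
independent⊎dependent {suc k} {suc n} v with pivot? v
... | inj₁ (i₀ , p≢0) = Sum.map independent-eliminated⇒independent dependent-eliminated⇒dependent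
                                (independent⊎dependent eliminated)
  where open Elimination v i₀ p≢0
... | inj₂ zeros      = Sum.map (Independent-tail {v = v}) dependent-dropped⇒dependent
                                (independent⊎dependent dropped)
  where open DropZeroColumn v zeros

independent⇒≤ : (v : Fin k → Vector ℚ n) → Independent v → k ≤ n
independent⇒≤ {zero}          v ind = z≤n
independent⇒≤ {suc k} {zero}  v ind = ⊥-elim (1≢0 (ind (λ _ → 1ℚ) (λ ()) zero))
independent⇒≤ {suc k} {suc n} v ind with pivot? v
... | inj₁ (i₀ , p≢0) = s≤s (independent⇒≤ eliminated (independent⇒independent-eliminated ind))
  where open Elimination v i₀ p≢0
... | inj₂ zeros      = ℕ.m≤n⇒m≤1+n (independent⇒≤ dropped (independent⇒independent-dropped ind))
  where open DropZeroColumn v zeros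

InSpan : (Fin k → Vector ℚ n) → Vector ℚ n → Set
InSpan v x = Σ (Vector ℚ _) λ α → ∀ j → x j ≡ lincomb α v j

lincomb-injective : {v : Fin k → Vector ℚ n} → Independent v → ∀ (α β : Vector ℚ k) →
  (∀ j → lincomb α v j ≡ lincomb β v j) → ∀ t → α t ≡ β t
lincomb-injective {v = v} ind α β α≡β t = begin
  α t
    ≡⟨ solve 2 (λ a b → a := (con 1ℚ :* a :+ con (- 1ℚ) :* b) :+ b) refl (α t) (β t) ⟩
  (1ℚ * α t + (- 1ℚ) * β t) + β t
    ≡⟨ cong (_+ β t) (ind (λ i → 1ℚ * α i + (- 1ℚ) * β i) difference t) ⟩
  0ℚ + β t
    ≡⟨ +-identityˡ (β t) ⟩
  β t ∎
  where
  open ≡-Reasoning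
  difference : ∀ j → lincomb (λ i → 1ℚ * α i + (- 1ℚ) * β i) v j ≡ 0ℚ
  difference j = trans (lincomb-linear α β v 1ℚ (- 1ℚ) j)
    (trans (cong (λ x → 1ℚ * x + (- 1ℚ) * lincomb β v j) (α≡β j))
           (solve 1 (λ x → con 1ℚ :* x :+ con (- 1ℚ) :* x := con 0ℚ) refl (lincomb β v j)))

InSpan-member : (v : Fin k → Vector ℚ n) → ∀ t → InSpan v (v t)
InSpan-member v t = unit t , λ j → sym (unit-· t (λ i → v i j))

InSpan-trans : {v : Fin k → Vector ℚ n} {w : Fin k′ → Vector ℚ n} {x : Vector ℚ n} →
  (∀ i → InSpan w (v i)) → InSpan v x → InSpan w x
InSpan-trans {v = v} {w} {x} v⊆w (α , x≡αv) = lincomb α (proj₁ ∘ v⊆w) , λ j → begin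
  x j                                            ≡⟨ x≡αv j ⟩
  lincomb α v j                                  ≡⟨ lincomb-cong α (λ i → proj₂ (v⊆w i)) j ⟩
  lincomb α (λ i → lincomb (proj₁ (v⊆w i)) w) j  ≡⟨ lincomb-assoc α (proj₁ ∘ v⊆w) w j ⟩
  lincomb (lincomb α (proj₁ ∘ v⊆w)) w j          ∎
  where open ≡-Reasoning

InSpan⇒¬independent-∷ : {v : Fin k → Vector ℚ n} {x : Vector ℚ n} → InSpan v x → ¬ Independent (x ∷ v)
InSpan⇒¬independent-∷ {v = v} {x} (α , x≡αv) ind = -1≢0 (ind (- 1ℚ ∷ α) relation zero)
  where
  -1≢0 : - 1ℚ ≢ 0ℚ
  -1≢0 ()
  relation : ∀ j → lincomb (- 1ℚ ∷ α) (x ∷ v) j ≡ 0ℚ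
  relation j = trans (cong (λ y → - 1ℚ * y + lincomb α v j) (x≡αv j))
    (solve 1 (λ y → con (- 1ℚ) :* y :+ y := con 0ℚ) refl (lincomb α v j))

dependent-∷⇒InSpan : {v : Fin k → Vector ℚ n} {x : Vector ℚ n} → Independent v → Dependent (x ∷ v) → InSpan v x
dependent-∷⇒InSpan {v = v} {x} ind (c , h , i , cᵢ≢0) with c zero ≟ 0ℚ
... | yes c₀≡0 = ⊥-elim (cᵢ≢0 (all-zero i))
  where
  open ≡-Reasoning
  tail-relation : ∀ j → lincomb (c ∘ suc) v j ≡ 0ℚ
  tail-relation j = begin
    lincomb (c ∘ suc) v j                ≡⟨ sym (+-identityˡ _) ⟩
    0ℚ + lincomb (c ∘ suc) v j           ≡⟨ cong (_+ lincomb (c ∘ suc) v j) (sym c₀x≡0) ⟩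
    c zero * x j + lincomb (c ∘ suc) v j ≡⟨ h j ⟩
    0ℚ                                   ∎
    where
    c₀x≡0 : c zero * x j ≡ 0ℚ
    c₀x≡0 = trans (cong (_* x j) c₀≡0) (*-zeroˡ (x j))
  all-zero : ∀ i → c i ≡ 0ℚ
  all-zero zero    = c₀≡0
  all-zero (suc t) = ind (c ∘ suc) tail-relation t
... | no c₀≢0 = (λ t → c (suc t) * - (1/ c zero)) , λ j → begin
  x j                                           ≡⟨ sym (*-identityˡ (x j)) ⟩
  1ℚ * x j                                      ≡⟨ cong (_* x j) (sym (*-inverseˡ (c zero))) ⟩
  1/ c zero * c zero * x j                      ≡⟨ *-assoc (1/ c zero) (c zero) (x j) ⟩
  1/ c zero * (c zero * x j)                    ≡⟨ cong (1/ c zero *_) (inverseˡ-unique (c zero * x j) _ (h j)) ⟩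
  1/ c zero * - lincomb (c ∘ suc) v j           ≡⟨ solve 2 (λ c⁻¹ s → c⁻¹ :* (:- s) := (:- c⁻¹) :* s)
                                                           refl (1/ c zero) _ ⟩
  - (1/ c zero) * lincomb (c ∘ suc) v j         ≡⟨ sym (·-scaleˡ (c ∘ suc) (λ t → v t j) (- (1/ c zero))) ⟩
  lincomb (λ t → c (suc t) * - (1/ c zero)) v j ∎
  where
  open ≡-Reasoning
  instance _ = ≢-nonZero c₀≢0

spanned⇒¬independent : (v : Fin (suc r) → Vector ℚ n) (w : Fin r → Vector ℚ n) →
  (∀ i → InSpan w (v i)) → ¬ Independent v
spanned⇒¬independent v w v⊆w ind = ℕ.1+n≰n (independent⇒≤ (proj₁ ∘ v⊆w) coefficients-independent)
  where
  coefficients-independent : Independent (proj₁ ∘ v⊆w)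
  coefficients-independent c h = ind c (λ j → begin
    lincomb c v j                                  ≡⟨ lincomb-cong c (λ i → proj₂ (v⊆w i)) j ⟩
    lincomb c (λ i → lincomb (proj₁ (v⊆w i)) w) j  ≡⟨ lincomb-assoc c (proj₁ ∘ v⊆w) w j ⟩
    lincomb (lincomb c (proj₁ ∘ v⊆w)) w j          ≡⟨ ·-zeroˡ h ⟩
    0ℚ                                             ∎)
    where open ≡-Reasoning

independent-square⇒InSpan : (v : Fin n → Vector ℚ n) → Independent v → ∀ x → InSpan v x
independent-square⇒InSpan v ind x with independent⊎dependent (x ∷ v)
... | inj₁ ind′ = ⊥-elim (ℕ.1+n≰n (independent⇒≤ (x ∷ v) ind′))
... | inj₂ dep  = dependent-∷⇒InSpan ind dep

record Basis (v : Fin k → Vector ℚ n) : Set where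
  field
    size        : ℕ
    index       : Fin size → Fin k
    independent : Independent (v ∘ index)
    spans       : ∀ i → InSpan (v ∘ index) (v i)

basis : (v : Fin k → Vector ℚ n) → Basis v
basis {zero}  v = record { size = 0 ; index = λ () ; independent = λ _ _ () ; spans = λ () }
basis {suc k} v with basis (v ∘ suc)
... | record { size = r ; index = s ; independent = ind ; spans = sp }
    with independent⊎dependent (v zero ∷ v ∘ suc ∘ s)
...   | inj₂ dep  = record
  { size = r ; index = suc ∘ s ; independent = ind
  ; spans = λ { zero → dependent-∷⇒InSpan ind dep ; (suc i) → sp i } }
...   | inj₁ ind′ = record
  { size = suc r ; index = zero ∷ suc ∘ s
  ; independent = Independent-cong {v = v zero ∷ v ∘ suc ∘ s} {w = v′}
                                   (λ { zero j → refl ; (suc a) j → refl }) ind′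
  ; spans = λ { zero    → InSpan-member v′ zero
              ; (suc i) → InSpan-trans {w = v′} (λ a → InSpan-member v′ (suc a)) (sp i) } }
  where
  v′ : Fin (suc r) → Vector ℚ _
  v′ = v ∘ (zero ∷ suc ∘ s)

InSpan? : (v : Fin k → Vector ℚ n) (x : Vector ℚ n) → Dec (InSpan v x)
InSpan? v x with basis v
... | record { index = s ; independent = ind ; spans = sp } with independent⊎dependent (x ∷ v ∘ s)
...   | inj₁ ind′ = no (λ x∈v → InSpan⇒¬independent-∷ (InSpan-trans sp x∈v) ind′)
...   | inj₂ dep  = yes (InSpan-trans (λ a → InSpan-member v (s a)) (dependent-∷⇒InSpan ind dep))

augmented-InSpan⇔ : {N : Fin k → Vector ℚ n} → Independent N → ∀ {μ x} → (∀ j → x j ≡ lincomb μ N j) →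
  ∀ (y : Vector ℚ k) b → InSpan (λ t → y t ∷ N t) (b ∷ x) ⇔ (b ≡ μ · y)
augmented-InSpan⇔ ind {μ} x≡μN y b = mk⇔
  (λ (α , h) → trans (h zero) (·-congˡ y (lincomb-injective ind α μ (λ j → trans (sym (h (suc j))) (x≡μN j)))))
  (λ b≡μy → μ , λ { zero → b≡μy ; (suc j) → x≡μN j })

-- Bits as zeros of a quadratic form

∑-↑ : ∀ {m n} (f : Vector ℚ (m ℕ.+ n)) → sum f ≡ sum (f ∘ (_↑ˡ n)) + sum (f ∘ (m ↑ʳ_))
∑-↑ {zero}      f = sym (+-identityˡ (sum f))
∑-↑ {suc m} {n} f = trans (cong (f zero +_) (∑-↑ {m} {n} (f ∘ suc)))
  (sym (+-assoc (f zero) (sum (f ∘ suc ∘ (_↑ˡ n))) (sum (f ∘ suc ∘ (m ↑ʳ_)))))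

∑-combine : ∀ {m n} (f : Vector ℚ (m ℕ.* n)) → sum f ≡ sum {m} (λ a → sum {n} (λ b → f (combine a b)))
∑-combine {zero}      f = refl
∑-combine {suc m} {n} f = trans (∑-↑ {n} {m ℕ.* n} f)
  (cong (sum {n} (λ b → f (b ↑ˡ m ℕ.* n)) +_) (∑-combine {m} {n} (f ∘ (n ↑ʳ_))))

outer : ∀ {m n} → Vector ℚ m → Vector ℚ n → Vector ℚ (m ℕ.* n)
outer {n = n} u v e = uncurry (λ a b → u a * v b) (remQuot n e)

outer-· : ∀ {m n} (u x : Vector ℚ m) (v y : Vector ℚ n) → outer u v · outer x y ≡ (u · x) * (v · y)
outer-· {m} {n} u x v y = begin
  outer u v · outer x y
    ≡⟨ ∑-combine {m} {n} (λ e → outer u v e * outer x y e) ⟩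
  sum {m} (λ a → sum {n} (λ b → outer u v (combine a b) * outer x y (combine a b)))
    ≡⟨ sum-cong-≗ (λ a → sum-cong-≗ (λ b → cong₂ _*_ (outer-combine u v a b) (outer-combine x y a b))) ⟩
  sum {m} (λ a → sum {n} (λ b → (u a * v b) * (x a * y b)))
    ≡⟨ sum-cong-≗ (λ a → trans (sum-cong-≗ (λ b → regroup (u a) (v b) (x a) (y b)))
                                (sym (*-distribˡ-sum (u a * x a) (λ b → v b * y b)))) ⟩
  sum {m} (λ a → (u a * x a) * (v · y))
    ≡⟨ sym (*-distribʳ-sum (v · y) (λ a → u a * x a)) ⟩
  (u · x) * (v · y) ∎
  where
  open ≡-Reasoning
  outer-combine : ∀ {m n} (u : Vector ℚ m) (v : Vector ℚ n) a b → outer u v (combine a b) ≡ u a * v b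
  outer-combine u v a b = cong (uncurry (λ a b → u a * v b)) (remQuot-combine a b)
  regroup : ∀ p q r s → (p * q) * (r * s) ≡ (p * r) * (q * s)
  regroup = solve 4 (λ p q r s → (p :* q) :* (r :* s) := (p :* r) :* (q :* s)) refl

IsBit : ℚ → Set
IsBit t = Σ Bool λ b → t ≡ toℚ b

IsBit⇒root : ∀ {t} → IsBit t → t * (- 1ℚ + t) ≡ 0ℚ
IsBit⇒root (true  , refl) = refl
IsBit⇒root (false , refl) = refl

root⇒IsBit : ∀ t → t * (- 1ℚ + t) ≡ 0ℚ → IsBit t
root⇒IsBit t root with t ≟ 0ℚ
... | yes t≡0 = false , t≡0
... | no  t≢0 = true , t≡1
  where
  open ≡-Reasoning
  t≡1 : t ≡ 1ℚ
  t≡1 = begin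
    t               ≡⟨ solve 1 (λ t → t := (con (- 1ℚ) :+ t) :+ con 1ℚ) refl t ⟩
    (- 1ℚ + t) + 1ℚ ≡⟨ cong (_+ 1ℚ) (*-cancelʳ-≡0 {q = - 1ℚ + t} t≢0 (trans (*-comm (- 1ℚ + t) t) root)) ⟩
    0ℚ + 1ℚ         ≡⟨ +-identityˡ 1ℚ ⟩
    1ℚ              ∎

-- μ · y is a bit iff the linear form `quadric μ` vanishes on `monomials y`.
quadric : Vector ℚ n → Vector ℚ (suc n ℕ.* suc n)
quadric μ = outer (0ℚ ∷ μ) (- 1ℚ ∷ μ)

monomials : Vector ℚ n → Vector ℚ (suc n ℕ.* suc n)
monomials y = outer (1ℚ ∷ y) (1ℚ ∷ y)

quadric-· : ∀ (μ y : Vector ℚ n) → quadric μ · monomials y ≡ (μ · y) * (- 1ℚ + μ · y)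
quadric-· μ y = trans (outer-· (0ℚ ∷ μ) (1ℚ ∷ y) (- 1ℚ ∷ μ) (1ℚ ∷ y))
                      (cong (_* (- 1ℚ + μ · y)) (+-identityˡ (μ · y)))

InSpan-·-zero : {v : Fin k → Vector ℚ n} {x ψ : Vector ℚ n} → InSpan v x → (∀ i → v i · ψ ≡ 0ℚ) → x · ψ ≡ 0ℚ
InSpan-·-zero {v = v} {x} {ψ} (α , x≡αv) vψ≡0 = begin
  x · ψ               ≡⟨ ·-congˡ ψ x≡αv ⟩
  lincomb α v · ψ     ≡⟨ lincomb-· α v ψ ⟩
  α · (λ i → v i · ψ) ≡⟨ ·-zeroʳ {u = α} vψ≡0 ⟩
  0ℚ                  ∎
  where open ≡-Reasoning

pad : ∀ {A : Set} {r m} → r ≤ m → A → (Fin r → A) → Fin m → A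
pad z≤n       a f k       = a
pad (s≤s r≤m) a f zero    = f zero
pad (s≤s r≤m) a f (suc k) = pad r≤m a (f ∘ suc) k

pad-inject≤ : ∀ {A : Set} {r m} (r≤m : r ≤ m) (a : A) (f : Fin r → A) i → pad r≤m a f (inject≤ i r≤m) ≡ f i
pad-inject≤ (s≤s r≤m) a f zero    = refl
pad-inject≤ (s≤s r≤m) a f (suc i) = pad-inject≤ r≤m a (f ∘ suc) i

spanning-sample : ∀ {m} (F : Fin m → Vector ℚ n) → Fin m → Σ (Fin n → Fin m) λ ρ → ∀ i → InSpan (F ∘ ρ) (F i)
spanning-sample F i₀ = ρ , λ i → InSpan-trans basis-in-sample (spans i)
  where
  open Basis (basis F)
  size≤n : size ≤ _
  size≤n = independent⇒≤ (F ∘ index) independent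
  ρ : Fin _ → Fin _
  ρ = pad size≤n i₀ index
  basis-in-sample : ∀ a → InSpan (F ∘ ρ) (F (index a))
  basis-in-sample a = subst (InSpan (F ∘ ρ) ∘ F) (pad-inject≤ size≤n i₀ index a)
                            (InSpan-member (F ∘ ρ) (inject≤ a size≤n))

bit-certifying-sample : ∀ {m} (μ : Fin m → Vector ℚ n) → Fin m →
  Σ (Fin (suc n ℕ.* suc n) → Fin m) λ ρ → ∀ y → (∀ s → IsBit (μ (ρ s) · y)) → ∀ i → IsBit (μ i · y)
bit-certifying-sample μ i₀ = ρ , λ y sample-bits i → root⇒IsBit (μ i · y) (begin
  μ i · y * (- 1ℚ + μ i · y)   ≡⟨ sym (quadric-· (μ i) y) ⟩
  quadric (μ i) · monomials y  ≡⟨ InSpan-·-zero {v = quadric ∘ μ ∘ ρ} {ψ = monomials y} (spans i)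
                                    (λ s → trans (quadric-· (μ (ρ s)) y) (IsBit⇒root (sample-bits s))) ⟩
  0ℚ                           ∎)
  where
  open ≡-Reasoning
  ρ : Fin _ → Fin _
  ρ = proj₁ (spanning-sample (quadric ∘ μ) i₀)
  spans : ∀ i → InSpan (quadric ∘ μ ∘ ρ) (quadric (μ i))
  spans = proj₂ (spanning-sample (quadric ∘ μ) i₀)

row : ∀ {m} → Mat01 m n → Fin m → Vector ℚ n
row A i j = toℚ (A i j)

toℚ-injective : ∀ {a b} → toℚ a ≡ toℚ b → a ≡ b
toℚ-injective {true}  {true}  _ = refl
toℚ-injective {false} {false} _ = refl
toℚ-injective {true}  {false} ()
toℚ-injective {false} {true}  ()

record RowBasis {m} (A : Mat01 m n) (d : ℕ) : Set where
  field
    σ           : Fin d → Fin m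
    injective   : Injective _≡_ _≡_ σ
    independent : Independent (row A ∘ σ)
    spans       : ∀ i → InSpan (row A ∘ σ) (row A i)

RowBasis⇒HasRank : ∀ {m d} {A : Mat01 m n} → RowBasis A d → HasRank A d
RowBasis⇒HasRank {A = A} rb = (σ , injective , Independent⇒LinIndep independent) ,
  λ σ′ _ ind′ → spanned⇒¬independent (row A ∘ σ′) (row A ∘ σ) (spans ∘ σ′)
                                      (LinIndep⇒Independent {v = row A ∘ σ′} ind′)
  where open RowBasis rb

HasRank⇒RowBasis : ∀ {m d} {A : Mat01 m n} → HasRank A d → RowBasis A d
HasRank⇒RowBasis {A = A} ((σ , injective , ind) , no-more) = record
  { σ = σ ; injective = injective ; independent = LinIndep⇒Independent ind ; spans = spans }
  where
  spans : ∀ i → InSpan (row A ∘ σ) (row A i)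
  spans i with any? (λ t → σ t Fin.≟ i)
  ... | yes (t , refl) = InSpan-member (row A ∘ σ) t
  ... | no i∉σ with independent⊎dependent (row A i ∷ row A ∘ σ)
  ...   | inj₂ dep  = dependent-∷⇒InSpan (LinIndep⇒Independent ind) dep
  ...   | inj₁ ind′ = ⊥-elim (no-more (i ∷ σ) i∷σ-injective (Independent⇒LinIndep {v = row A ∘ (i ∷ σ)}
                        (Independent-cong {v = row A i ∷ row A ∘ σ} {w = row A ∘ (i ∷ σ)}
                                          (λ { zero j → refl ; (suc t) j → refl }) ind′)))
    where
    i∷σ-injective : Injective _≡_ _≡_ (i ∷ σ)
    i∷σ-injective {zero}  {zero}  _ = refl
    i∷σ-injective {zero}  {suc t} e = ⊥-elim (i∉σ (t , sym e))
    i∷σ-injective {suc t} {zero}  e = ⊥-elim (i∉σ (t , e))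
    i∷σ-injective {suc t} {suc u} e = cong suc (injective e)

-- Opaque, so that conversion checks never unfold the Gaussian elimination inside it.
opaque
  square-minor : ∀ {d} (R : Fin d → Vector ℚ n) → Independent R →
    Σ (Fin d → Fin n) λ τ → Independent (λ t k → R t (τ k))
  square-minor {n = n} {d = d} R ind = square index minor-independent
    (ℕ.≤-antisym (independent⇒≤ (columns ∘ index) independent) (independent⇒≤ _ minor-independent))
    where
    columns : Fin n → Vector ℚ d
    columns j t = R t j
    open Basis (basis columns)
    minor-independent : Independent (λ t a → R t (index a))
    minor-independent c h = ind c (λ j → begin
      c · columns j                                      ≡⟨ ·-congʳ c (proj₂ (spans j)) ⟩
      c · (λ t → proj₁ (spans j) · (λ a → R t (index a))) ≡⟨ ·-congʳ c (λ t → ·-comm (proj₁ (spans j)) _) ⟩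
      c · (λ t → (λ a → R t (index a)) · proj₁ (spans j))
        ≡⟨ sym (lincomb-· c (λ t a → R t (index a)) (proj₁ (spans j))) ⟩
      lincomb c (λ t a → R t (index a)) · proj₁ (spans j) ≡⟨ ·-zeroˡ h ⟩
      0ℚ                                                 ∎)
      where open ≡-Reasoning
    square : ∀ {r} (τ : Fin r → Fin n) → Independent (λ t a → R t (τ a)) → r ≡ d →
      Σ (Fin d → Fin n) λ τ → Independent (λ t k → R t (τ k))
    square τ ind′ refl = τ , ind′

appendColumn : ∀ {m} → Mat01 m n → (Fin m → Bool) → Mat01 m (suc n)
appendColumn A c i = c i ∷ A i

appendRow : ∀ {m} → Mat01 m n → (Fin n → Bool) → Mat01 (suc m) n
appendRow A r = r ∷ A

appendColumn-submatrix : ∀ {m} (A : Mat01 m n) c → SubmatrixOf A (appendColumn A c)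
appendColumn-submatrix A c = (λ i → i) , suc , (λ i j i<j → i<j) , (λ i j i<j → s≤s i<j) , (λ i j → refl)

appendRow-submatrix : ∀ {m} (A : Mat01 m n) r → SubmatrixOf A (appendRow A r)
appendRow-submatrix A r = suc , (λ j → j) , (λ i j i<j → s≤s i<j) , (λ i j i<j → i<j) , (λ i j → refl)

appendColumn-NoRepeatedRow : ∀ {m} {A : Mat01 m n} {c} → NoRepeatedRow A → NoRepeatedRow (appendColumn A c)
appendColumn-NoRepeatedRow distinct i i′ same = distinct i i′ (same ∘ suc)

appendColumn-NoRepeatedCol : ∀ {m} {A : Mat01 m n} {c} → NoRepeatedCol A → (∀ j → ¬ (∀ i → c i ≡ A i j)) →
  NoRepeatedCol (appendColumn A c)
appendColumn-NoRepeatedCol distinct new zero    zero     same = refl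
appendColumn-NoRepeatedCol distinct new zero    (suc j′) same = ⊥-elim (new j′ same)
appendColumn-NoRepeatedCol distinct new (suc j) zero     same = ⊥-elim (new j (sym ∘ same))
appendColumn-NoRepeatedCol distinct new (suc j) (suc j′) same = cong suc (distinct j j′ same)

appendRow-NoRepeatedRow : ∀ {m} {A : Mat01 m n} {r} → NoRepeatedRow A → (∀ i → ¬ (∀ j → r j ≡ A i j)) →
  NoRepeatedRow (appendRow A r)
appendRow-NoRepeatedRow distinct new zero    zero     same = refl
appendRow-NoRepeatedRow distinct new zero    (suc i′) same = ⊥-elim (new i′ same)
appendRow-NoRepeatedRow distinct new (suc i) zero     same = ⊥-elim (new i (sym ∘ same))
appendRow-NoRepeatedRow distinct new (suc i) (suc i′) same = cong suc (distinct i i′ same)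

appendRow-NoRepeatedCol : ∀ {m} {A : Mat01 m n} {r} → NoRepeatedCol A → NoRepeatedCol (appendRow A r)
appendRow-NoRepeatedCol distinct j j′ same = distinct j j′ (same ∘ suc)

-- Maximal matrices

module MaximalMatrix {m n d} (A : Mat01 m n) (maximal : Maximal d A) where

  open RowBasis (HasRank⇒RowBasis {A = A} (proj₁ (proj₁ maximal))) public

  distinct-rows : NoRepeatedRow A
  distinct-rows = proj₁ (proj₂ (proj₁ maximal))

  distinct-columns : NoRepeatedCol A
  distinct-columns = proj₂ (proj₂ (proj₁ maximal))

  coeff : Fin m → Vector ℚ d
  coeff i = proj₁ (spans i)

  column : Fin n → Vector ℚ d
  column j t = toℚ (A (σ t) j)

  entry≡ : ∀ i j → toℚ (A i j) ≡ coeff i · column j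
  entry≡ i j = proj₂ (spans i) j

  coeff-σ : ∀ t (y : Vector ℚ d) → coeff (σ t) · y ≡ y t
  coeff-σ t y = trans (·-congˡ y coeff≡unit) (unit-· t y)
    where
    coeff≡unit : ∀ s → coeff (σ t) s ≡ unit t s
    coeff≡unit = lincomb-injective independent (coeff (σ t)) (unit t)
                   (λ j → trans (sym (entry≡ (σ t) j)) (sym (unit-· t (column j))))

  τ : Fin d → Fin n
  τ = proj₁ (square-minor (row A ∘ σ) independent)

  core : Fin d → Vector ℚ d
  core t k = toℚ (A (σ t) (τ k))

  core-independent : Independent core
  core-independent = proj₂ (square-minor (row A ∘ σ) independent)

  rowPattern : Fin m → Fin d → Bool
  rowPattern i k = A i (τ k)

  columnPattern : Fin n → Fin d → Bool
  columnPattern j t = A (σ t) j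

  rowPattern≡ : ∀ i k → toℚ (rowPattern i k) ≡ lincomb (coeff i) core k
  rowPattern≡ i k = entry≡ i (τ k)

  rowPattern-injective : ∀ {i i′} → (∀ k → rowPattern i k ≡ rowPattern i′ k) → i ≡ i′
  rowPattern-injective {i} {i′} same = distinct-rows i i′ (λ j → toℚ-injective (begin
    toℚ (A i j)         ≡⟨ entry≡ i j ⟩
    coeff i · column j  ≡⟨ ·-congˡ (column j) same-coeff ⟩
    coeff i′ · column j ≡⟨ sym (entry≡ i′ j) ⟩
    toℚ (A i′ j)        ∎))
    where
    open ≡-Reasoning
    same-coeff : ∀ t → coeff i t ≡ coeff i′ t
    same-coeff = lincomb-injective core-independent (coeff i) (coeff i′)
      (λ k → trans (sym (rowPattern≡ i k)) (trans (cong toℚ (same k)) (rowPattern≡ i′ k)))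

  columnPattern-injective : ∀ {j j′} → (∀ t → columnPattern j t ≡ columnPattern j′ t) → j ≡ j′
  columnPattern-injective {j} {j′} same = distinct-columns j j′ (λ i → toℚ-injective
    (trans (entry≡ i j) (trans (·-congʳ (coeff i) (cong toℚ ∘ same)) (sym (entry≡ i j′)))))

  column-closure : (y : Fin d → Bool) → (∀ i → IsBit (coeff i · (toℚ ∘ y))) →
    ∃ λ j → ∀ t → columnPattern j t ≡ y t
  column-closure y bits with any? (λ j → all? (λ t → columnPattern j t Bool.≟ y t))
  ... | yes found = found
  ... | no  new   = ⊥-elim (ℕ.1+n≢n (sym (proj₂ (proj₂ maximal m (suc n) B B∈M
                                                  (appendColumn-submatrix A newColumn)))))
    where
    newColumn : Fin m → Bool
    newColumn i = proj₁ (bits i)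
    newColumn-σ : ∀ t → newColumn (σ t) ≡ y t
    newColumn-σ t = toℚ-injective (trans (sym (proj₂ (bits (σ t)))) (coeff-σ t (toℚ ∘ y)))
    B : Mat01 m (suc n)
    B = appendColumn A newColumn
    B-spans : ∀ i → InSpan (row B ∘ σ) (row B i)
    B-spans i = coeff i , λ
      { zero    → trans (sym (proj₂ (bits i))) (·-congʳ (coeff i) (λ t → cong toℚ (sym (newColumn-σ t))))
      ; (suc j) → entry≡ i j }
    B∈M : InM d B
    B∈M = RowBasis⇒HasRank {A = B} (record { σ = σ ; injective = injective
                                           ; independent = Independent-tail {v = row B ∘ σ} independent
                                           ; spans = B-spans }) ,
          appendColumn-NoRepeatedRow distinct-rows ,
          appendColumn-NoRepeatedCol distinct-columns
            (λ j same → new (j , λ t → trans (sym (same (σ t))) (newColumn-σ t)))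

  row-closure : (x : Fin d → Bool) (μ : Vector ℚ d) → (∀ k → toℚ (x k) ≡ lincomb μ core k) →
    (∀ j → IsBit (μ · column j)) → ∃ λ i → ∀ k → rowPattern i k ≡ x k
  row-closure x μ x≡μcore bits with any? (λ i → all? (λ k → rowPattern i k Bool.≟ x k))
  ... | yes found = found
  ... | no  new   = ⊥-elim (ℕ.1+n≢n (sym (proj₁ (proj₂ maximal (suc m) n B B∈M
                                                  (appendRow-submatrix A newRow)))))
    where
    newRow : Fin n → Bool
    newRow j = proj₁ (bits j)
    newRow-τ : ∀ k → newRow (τ k) ≡ x k
    newRow-τ k = toℚ-injective (trans (sym (proj₂ (bits (τ k)))) (sym (x≡μcore k)))
    B : Mat01 (suc m) n
    B = appendRow A newRow
    B-spans : ∀ i → InSpan (row B ∘ suc ∘ σ) (row B i)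
    B-spans zero    = μ , λ j → sym (proj₂ (bits j))
    B-spans (suc i) = spans i
    B∈M : InM d B
    B∈M = RowBasis⇒HasRank {A = B} (record { σ = suc ∘ σ ; injective = injective ∘ suc-injective
                                           ; independent = independent ; spans = B-spans }) ,
          appendRow-NoRepeatedRow distinct-rows
            (λ i same → new (i , λ k → trans (sym (same (τ k))) (newRow-τ k))) ,
          appendRow-NoRepeatedCol distinct-columns

funToFin-cong : ∀ {m n} {f g : Fin m → Fin n} → (∀ i → f i ≡ g i) → funToFin f ≡ funToFin g
funToFin-cong {zero}  f≗g = refl
funToFin-cong {suc m} f≗g = cong₂ combine (f≗g zero) (funToFin-cong (f≗g ∘ suc))

encode : ∀ {d} → (Fin d → Bool) → Fin (2 ^ d)
encode p = funToFin (Inverse.from 2↔Bool ∘ p)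

decode : ∀ {d} → Fin (2 ^ d) → Fin d → Bool
decode κ = Inverse.to 2↔Bool ∘ finToFun κ

decode-encode : ∀ {d} (p : Fin d → Bool) k → decode (encode p) k ≡ p k
decode-encode p k = trans (cong (Inverse.to 2↔Bool) (finToFun-funToFin _ k))
                          (Inverse.strictlyInverseˡ 2↔Bool (p k))

encode-decode : ∀ {d} (κ : Fin (2 ^ d)) → encode (decode {d} κ) ≡ κ
encode-decode {d} κ = trans (funToFin-cong (Inverse.strictlyInverseʳ 2↔Bool ∘ finToFun {2} {d} κ))
                            (funToFin-finToFin {d} κ)

encode-cong : ∀ {d} {p q : Fin d → Bool} → (∀ k → p k ≡ q k) → encode p ≡ encode q
encode-cong p≗q = funToFin-cong (cong (Inverse.from 2↔Bool) ∘ p≗q)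

encode-injective : ∀ {d} {p q : Fin d → Bool} → encode p ≡ encode q → ∀ k → p k ≡ q k
encode-injective {p = p} {q} same k =
  trans (sym (decode-encode p k)) (trans (cong (λ κ → decode κ k) same) (decode-encode q k))

lookup-injective : ∀ {A : Set} (xs : List A) → Unique xs → ∀ {p q} → List.lookup xs p ≡ List.lookup xs q → p ≡ q
lookup-injective (x List.∷ xs) (x∉xs AllPairs.∷ _)      {zero}  {zero}  _ = refl
lookup-injective (x List.∷ xs) (x∉xs AllPairs.∷ _)      {zero}  {suc q} e = ⊥-elim (All.lookup x∉xs (∈-lookup q) e)
lookup-injective (x List.∷ xs) (x∉xs AllPairs.∷ _)      {suc p} {zero}  e = ⊥-elim (All.lookup x∉xs (∈-lookup p) (sym e))
lookup-injective (x List.∷ xs) (_    AllPairs.∷ unique) {suc p} {suc q} e = cong suc (lookup-injective xs unique e)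

enumeration-↔ : ∀ {A : Set} {m} (xs : List A) → Unique xs → (f : Fin m → A) → Injective _≡_ _≡_ f →
  (∀ i → f i ∈ xs) → (∀ {x} → x ∈ xs → ∃ λ i → f i ≡ x) →
  Σ (Fin m ↔ Fin (List.length xs)) λ e → ∀ i → List.lookup xs (Inverse.to e i) ≡ f i
enumeration-↔ {m = m} xs unique f injective complete sound =
  mk↔ₛ′ position entry position∘entry entry∘position , lookup-position
  where
  position : Fin m → Fin (List.length xs)
  position i = Any.index (complete i)
  lookup-position : ∀ i → List.lookup xs (position i) ≡ f i
  lookup-position i = sym (lookup-index (complete i))
  entry : Fin (List.length xs) → Fin m
  entry p = proj₁ (sound (∈-lookup p))
  position∘entry : ∀ p → position (entry p) ≡ p
  position∘entry p = lookup-injective xs unique (trans (lookup-position (entry p)) (proj₂ (sound (∈-lookup p))))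
  entry∘position : ∀ i → entry (position i) ≡ i
  entry∘position i = injective (trans (proj₂ (sound (∈-lookup (position i)))) (lookup-position i))

does-⇔ : ∀ {P : Set} (P? : Dec P) {b} → P ⇔ (b ≡ true) → does P? ≡ b
does-⇔ (yes p)         P⇔b = sym (Equivalence.to P⇔b p)
does-⇔ (no ¬p) {true}  P⇔b = ⊥-elim (¬p (Equivalence.from P⇔b refl))
does-⇔ (no ¬p) {false} P⇔b = refl

-- Reconstruction from a certificate

Samples : ℕ → ℕ
Samples d = suc d ℕ.* suc d

record Certificate (d : ℕ) : Set where
  field
    coreCodes   : Fin d → Fin (2 ^ d)
    sampleCodes : Fin (Samples d) → Fin (2 ^ d)

open Certificate

module Decoding {d} (c : Certificate d) where

  bits : Fin (2 ^ d) → Vector ℚ d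
  bits κ k = toℚ (decode {d} κ k)

  coreRows : Fin d → Vector ℚ d
  coreRows t = bits (coreCodes c t)

  -- For a nonsingular core N this says (x N⁻¹) · y = b, without having to invert N.
  Value : Fin (2 ^ d) → Fin (2 ^ d) → Bool → Set
  Value x y b = InSpan (λ t → bits y t ∷ coreRows t) (toℚ b ∷ bits x)

  Value? : ∀ x y b → Dec (Value x y b)
  Value? x y b = InSpan? _ _

  Compatible : Fin (2 ^ d) → Fin (2 ^ d) → Set
  Compatible x y = Value x y true ⊎ Value x y false

  Compatible? : ∀ x y → Dec (Compatible x y)
  Compatible? x y = Value? x y true ⊎-dec Value? x y false

  IsColumnCode : Fin (2 ^ d) → Set
  IsColumnCode y = ∀ s → Compatible (sampleCodes c s) y

  IsColumnCode? : ∀ y → Dec (IsColumnCode y)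
  IsColumnCode? y = all? (λ s → Compatible? (sampleCodes c s) y)

  columnCodes : List (Fin (2 ^ d))
  columnCodes = List.filter IsColumnCode? (List.allFin (2 ^ d))

  IsRowCode : Fin (2 ^ d) → Set
  IsRowCode x = All (Compatible x) columnCodes

  IsRowCode? : ∀ x → Dec (IsRowCode x)
  IsRowCode? x = All.all? (Compatible? x) columnCodes

  rowCodes : List (Fin (2 ^ d))
  rowCodes = List.filter IsRowCode? (List.allFin (2 ^ d))

  matrix : Mat01 (List.length rowCodes) (List.length columnCodes)
  matrix p q = does (Value? (List.lookup rowCodes p) (List.lookup columnCodes q) true)

reconstruct : ∀ {d} → Certificate d → AnyMat
reconstruct c = _ , _ , Decoding.matrix c

module Reconstruction {m n d} (A : Mat01 m n) (maximal : Maximal d A) where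

  open MaximalMatrix A maximal

  rowCode : Fin m → Fin (2 ^ d)
  rowCode i = encode (rowPattern i)

  columnCode : Fin n → Fin (2 ^ d)
  columnCode j = encode (columnPattern j)

  module _ (ρ : Fin (Samples d) → Fin m)
           (certifies : ∀ y → (∀ s → IsBit (coeff (ρ s) · y)) → ∀ i → IsBit (coeff i · y))
           (c : Certificate d)
           (core-agrees : ∀ t k → decode (coreCodes c t) k ≡ rowPattern (σ t) k)
           (sample-agrees : ∀ s k → decode (sampleCodes c s) k ≡ rowPattern (ρ s) k)
           where

    open Decoding c

    coreRows≡core : ∀ t k → coreRows t k ≡ core t k
    coreRows≡core t k = cong toℚ (core-agrees t k)

    coreRows-independent : Independent coreRows
    coreRows-independent = Independent-cong (λ t k → sym (coreRows≡core t k)) core-independent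

    bits-row : ∀ {x} i → (∀ k → decode x k ≡ rowPattern i k) → ∀ k → bits x k ≡ lincomb (coeff i) coreRows k
    bits-row i x≗i k = trans (cong toℚ (x≗i k))
                             (trans (rowPattern≡ i k) (sym (lincomb-cong (coeff i) coreRows≡core k)))

    bits-columnCode : ∀ j t → bits (columnCode j) t ≡ column j t
    bits-columnCode j t = cong toℚ (decode-encode (columnPattern j) t)

    Compatible⇔IsBit : ∀ {x μ} → (∀ k → bits x k ≡ lincomb μ coreRows k) →
      ∀ y → Compatible x y ⇔ IsBit (μ · bits y)
    Compatible⇔IsBit {μ = μ} x≡μN y = mk⇔
      (λ { (inj₁ v) → true  , sym (Equivalence.to (value true) v)
         ; (inj₂ v) → false , sym (Equivalence.to (value false) v) })
      (λ { (true  , e) → inj₁ (Equivalence.from (value true) (sym e))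
         ; (false , e) → inj₂ (Equivalence.from (value false) (sym e)) })
      where
      value : ∀ b → Value _ y b ⇔ (toℚ b ≡ μ · bits y)
      value b = augmented-InSpan⇔ coreRows-independent {μ = μ} x≡μN (bits y) (toℚ b)

    compatible-codes : ∀ {x} i → (∀ k → decode x k ≡ rowPattern i k) → ∀ j → Compatible x (columnCode j)
    compatible-codes i x≗i j = Equivalence.from (Compatible⇔IsBit {μ = coeff i} (bits-row i x≗i) (columnCode j))
      (A i j , trans (·-congʳ (coeff i) (bits-columnCode j)) (sym (entry≡ i j)))

    columnCode∈ : ∀ j → columnCode j ∈ columnCodes
    columnCode∈ j = ∈-filter⁺ IsColumnCode? (∈-allFin _) (λ s → compatible-codes (ρ s) (sample-agrees s) j)

    columnCodes-sound : ∀ {y} → y ∈ columnCodes → ∃ λ j → columnCode j ≡ y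
    columnCodes-sound {y} y∈ = map₂ (λ same → trans (encode-cong same) (encode-decode {d} y))
      (column-closure (decode y) (certifies (bits y) sample-bits))
      where
      sample-bits : ∀ s → IsBit (coeff (ρ s) · bits y)
      sample-bits s = Equivalence.to (Compatible⇔IsBit {μ = coeff (ρ s)} (bits-row (ρ s) (sample-agrees s)) y)
                                     (proj₂ (∈-filter⁻ IsColumnCode? {xs = List.allFin (2 ^ d)} y∈) s)

    rowCode∈ : ∀ i → rowCode i ∈ rowCodes
    rowCode∈ i = ∈-filter⁺ IsRowCode? (∈-allFin _) (All.tabulate λ y∈ →
      subst (Compatible (rowCode i)) (proj₂ (columnCodes-sound y∈))
            (compatible-codes i (decode-encode (rowPattern i)) (proj₁ (columnCodes-sound y∈))))

    rowCodes-sound : ∀ {x} → x ∈ rowCodes → ∃ λ i → rowCode i ≡ x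
    rowCodes-sound {x} x∈ = closed (independent-square⇒InSpan coreRows coreRows-independent (bits x))
      where
      closed : InSpan coreRows (bits x) → ∃ λ i → rowCode i ≡ x
      closed (μ , x≡μN) = map₂ (λ same → trans (encode-cong same) (encode-decode {d} x))
        (row-closure (decode x) μ (λ k → trans (x≡μN k) (lincomb-cong μ coreRows≡core k)) column-bits)
        where
        column-bits : ∀ j → IsBit (μ · column j)
        column-bits j = subst IsBit (·-congʳ μ (bits-columnCode j))
          (Equivalence.to (Compatible⇔IsBit {μ = μ} x≡μN (columnCode j))
                          (All.lookup (proj₂ (∈-filter⁻ IsRowCode? {xs = List.allFin (2 ^ d)} x∈))
                                      (columnCode∈ j)))

    rows↔ : Σ (Fin m ↔ Fin (List.length rowCodes)) λ e → ∀ i → List.lookup rowCodes (Inverse.to e i) ≡ rowCode i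
    rows↔ = enumeration-↔ rowCodes (filter⁺ IsRowCode? (allFin⁺ _)) rowCode
              (λ same → rowPattern-injective (encode-injective same)) rowCode∈ rowCodes-sound

    columns↔ : Σ (Fin n ↔ Fin (List.length columnCodes)) λ e →
                 ∀ j → List.lookup columnCodes (Inverse.to e j) ≡ columnCode j
    columns↔ = enumeration-↔ columnCodes (filter⁺ IsColumnCode? (allFin⁺ _)) columnCode
                 (λ same → columnPattern-injective (encode-injective same)) columnCode∈ columnCodes-sound

    value⇔entry : ∀ i j b → Value (rowCode i) (columnCode j) b ⇔ (A i j ≡ b)
    value⇔entry i j b = mk⇔
      (λ v → toℚ-injective (trans (entry≡ i j) (trans (sym entry-bits) (sym (Equivalence.to value v)))))
      (λ Aᵢⱼ≡b → Equivalence.from value (trans (cong toℚ (sym Aᵢⱼ≡b)) (trans (entry≡ i j) (sym entry-bits))))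
      where
      entry-bits : coeff i · bits (columnCode j) ≡ coeff i · column j
      entry-bits = ·-congʳ (coeff i) (bits-columnCode j)
      value : Value (rowCode i) (columnCode j) b ⇔ (toℚ b ≡ coeff i · bits (columnCode j))
      value = augmented-InSpan⇔ coreRows-independent {μ = coeff i}
                (bits-row i (decode-encode (rowPattern i))) (bits (columnCode j)) (toℚ b)

    reconstruction-correct : PermEquivAny A (reconstruct c)
    reconstruction-correct = proj₁ rows↔ , proj₁ columns↔ , λ i j → sym (begin
      matrix (Inverse.to (proj₁ rows↔) i) (Inverse.to (proj₁ columns↔) j)
        ≡⟨ cong₂ (λ x y → does (Value? x y true)) (proj₂ rows↔ i) (proj₂ columns↔ j) ⟩
      does (Value? (rowCode i) (columnCode j) true)
        ≡⟨ does-⇔ (Value? (rowCode i) (columnCode j) true) (value⇔entry i j true) ⟩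
      A i j ∎)
      where open ≡-Reasoning

-- Counting certificates

CertificateCode : ℕ → Set
CertificateCode d = Fin ((2 ^ d) ^ (d ℕ.+ Samples d))

decodeCertificate : ∀ {d} → CertificateCode d → Certificate d
decodeCertificate {d} κ = record { coreCodes = codes ∘ (_↑ˡ Samples d) ; sampleCodes = codes ∘ (d ↑ʳ_) }
  where
  codes : Fin (d ℕ.+ Samples d) → Fin (2 ^ d)
  codes = finToFun {2 ^ d} {d ℕ.+ Samples d} κ

encodeCertificate : ∀ {d} → Certificate d → CertificateCode d
encodeCertificate {d} c = funToFin {d ℕ.+ Samples d} {2 ^ d} ([ coreCodes c , sampleCodes c ]′ ∘ Fin.splitAt d)

coreCodes-encode : ∀ {d} (c : Certificate d) t →
  coreCodes (decodeCertificate {d} (encodeCertificate c)) t ≡ coreCodes c t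
coreCodes-encode {d} c t = trans (finToFun-funToFin {d ℕ.+ Samples d} {2 ^ d} _ (t ↑ˡ Samples d))
  (cong [ coreCodes c , sampleCodes c ]′ (splitAt-↑ˡ d t (Samples d)))

sampleCodes-encode : ∀ {d} (c : Certificate d) s →
  sampleCodes (decodeCertificate {d} (encodeCertificate c)) s ≡ sampleCodes c s
sampleCodes-encode {d} c s = trans (finToFun-funToFin {d ℕ.+ Samples d} {2 ^ d} _ (d ↑ʳ s))
  (cong [ coreCodes c , sampleCodes c ]′ (splitAt-↑ʳ d (Samples d) s))

candidates : ℕ → List AnyMat
candidates d = List.map (reconstruct ∘ decodeCertificate {d}) (List.allFin ((2 ^ d) ^ (d ℕ.+ Samples d)))

reconstruct-∈-candidates : ∀ {d} (κ : CertificateCode d) → reconstruct (decodeCertificate {d} κ) ∈ candidates d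
reconstruct-∈-candidates {d} κ = ∈-map⁺ (reconstruct ∘ decodeCertificate {d}) (∈-allFin κ)

candidates-complete : ∀ {m n d} (A : Mat01 m n) → Maximal (suc d) A → Any (PermEquivAny A) (candidates (suc d))
candidates-complete {m} {d = d} A maximal =
  lose (reconstruct-∈-candidates {suc d} (encodeCertificate c))
       (reconstruction-correct ρ certifies (decodeCertificate (encodeCertificate c)) core-agrees sample-agrees)
  where
  open MaximalMatrix A maximal
  open Reconstruction A maximal
  ρ : Fin (Samples (suc d)) → Fin m
  ρ = proj₁ (bit-certifying-sample coeff (σ zero))
  certifies : ∀ y → (∀ s → IsBit (coeff (ρ s) · y)) → ∀ i → IsBit (coeff i · y)
  certifies = proj₂ (bit-certifying-sample coeff (σ zero))
  c : Certificate (suc d)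
  c = record { coreCodes = rowCode ∘ σ ; sampleCodes = rowCode ∘ ρ }
  core-agrees : ∀ t k → decode (coreCodes (decodeCertificate (encodeCertificate c)) t) k ≡ rowPattern (σ t) k
  core-agrees t k = trans (cong (λ κ → decode κ k) (coreCodes-encode c t)) (decode-encode (rowPattern (σ t)) k)
  sample-agrees : ∀ s k → decode (sampleCodes (decodeCertificate (encodeCertificate c)) s) k ≡ rowPattern (ρ s) k
  sample-agrees s k = trans (cong (λ κ → decode κ k) (sampleCodes-encode c s)) (decode-encode (rowPattern (ρ s)) k)

length-candidates : ∀ d → List.length (candidates d) ≡ 2 ^ (d ℕ.* (d ℕ.+ Samples d))
length-candidates d = begin
  List.length (candidates d)
    ≡⟨ List.length-map (reconstruct ∘ decodeCertificate {d}) (List.allFin _) ⟩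
  List.length (List.allFin ((2 ^ d) ^ (d ℕ.+ Samples d)))
    ≡⟨ List.length-tabulate {n = (2 ^ d) ^ (d ℕ.+ Samples d)} (λ i → i) ⟩
  (2 ^ d) ^ (d ℕ.+ Samples d)
    ≡⟨ ℕ.^-*-assoc 2 d (d ℕ.+ Samples d) ⟩
  2 ^ (d ℕ.* (d ℕ.+ Samples d)) ∎
  where open ≡-Reasoning

exponent-identity : ∀ d →
  (1 ℕ.+ d) ℕ.* ((1 ℕ.+ d) ℕ.+ (2 ℕ.+ d) ℕ.* (2 ℕ.+ d)) ℕ.+ (1 ℕ.+ d) ℕ.* (4 ℕ.* d ℕ.* d ℕ.+ 5 ℕ.* d)
    ≡ 5 ℕ.* ((1 ℕ.+ d) ℕ.* ((1 ℕ.+ d) ℕ.* ((1 ℕ.+ d) ℕ.* 1)))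
exponent-identity = solve-∀

exponent-bound : ∀ d → suc d ℕ.* (suc d ℕ.+ Samples (suc d)) ≤ 5 ℕ.* suc d ^ 3
exponent-bound d = subst (suc d ℕ.* (suc d ℕ.+ Samples (suc d)) ≤_) (exponent-identity d)
  (ℕ.m≤m+n (suc d ℕ.* (suc d ℕ.+ Samples (suc d))) (suc d ℕ.* (4 ℕ.* d ℕ.* d ℕ.+ 5 ℕ.* d)))

length-candidates-bound : ∀ d → List.length (candidates (suc d)) ≤ 2 ^ (5 ℕ.* suc d ^ 3)
length-candidates-bound d = subst (_≤ 2 ^ (5 ℕ.* suc d ^ 3)) (sym (length-candidates (suc d)))
                                  (ℕ.^-monoʳ-≤ 2 (exponent-bound d))

theorem4p1 : ∃[ C ] ∃[ d₀ ] ((d : ℕ) → d₀ ≤ d →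
    Σ (List AnyMat) λ reps →
      (List.length reps ≤ 2 ^ (C ℕ.* (d ^ 3))) ×
      ((m n : ℕ) (A : Mat01 m n) → Maximal d A → Any (PermEquivAny A) reps))
theorem4p1 = 5 , 1 , λ where
  (suc d) _ → candidates (suc d) , length-candidates-bound d , λ m n A → candidates-complete A
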